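{- Let $n,N$ be positive integers with $1\leq n\leq N$ and let $\mathbf z\in\mathcal C_n\setminus\mathcal S_n$. Then $\mathbf z\notin\mathcal R_n$ if and only if there exist an integer $1\leq i<n$ and $\mathbf x\in\mathcal R_i\setminus\mathcal S_i$ such that all entries of $\mathbf z-\mathbf x$ are non-negative.
   Context: $(h_k)_{k\geq0}$ is the Fibonacci sequence, $h_0=0$, $h_1=1$, $h_{k+1}=h_k+h_{k-1}$. Let $A$ be the $2\times N$ matrix with rows $(h_1,\ldots,h_N)$ and $(h_0,\ldots,h_{N-1})$. For $1\leq n\leq N$, $\mathcal V_n=\{\mathbf x\in\mathbb Z_{\geq0}^N:A\mathbf x=(h_n,h_{n-1})^T\}$. For $2\leq n\leq N$ and $3\leq i\leq n+1$, $\mathbf x_n(i)\in\mathbb R^N$ has entry $h_{n+1-i}$ in position $i-2$, $h_{n+2-i}$ in position $i-1$, and $0$ elsewhere; $\mathcal S_n=\{\mathbf x_n(i):3\leq i\leq n+1\}$; $\mathbf x_1(2)=(1,0,\ldots,0)$ and $\mathcal S_1=\{\mathbf x_1(2)\}$. $\mathbf z=(z_1,\ldots,z_N)\in\mathcal V_n$ is almost consecutive-free if $z_jz_{j+1}\neq0$ implies $z_i=0$ for all $i>j+1$; $\mathcal C_n$ is the set of almost consecutive-free elements of $\mathcal V_n$. A factorization of $\mathbf z\in\mathcal V_n$ is a tuple $(\mathbf x_1,\ldots,\mathbf x_K)$ with each $\mathbf x_k\in\bigcup_{i=1}^n\mathcal V_i$ and $\mathbf z=\sum_k\mathbf x_k$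 (up to permutation); the trivial factorization is $(\mathbf z)$ with $K=1$. A factorization is $\mathcal S$-type if every $\mathbf x_k\in\bigcup_{i=1}^n\mathcal S_i$. $\mathbf z$ is $\mathcal S$-restricted if all its non-trivial factorizations are $\mathcal S$-type; $\mathcal R_n$ is the set of $\mathcal S$-restricted elements of $\mathcal C_n$. -}

module Defs where

open import Data.Nat using (ℕ; zero; suc; _+_; _*_; _∸_; _≤_; _<_)
open import Data.Nat.Properties using (_≟_)
open import Data.Fin using (Fin; toℕ)
open import Data.Vec using (Vec; tabulate; zipWith; replicate; lookup; toList; foldr)
open import Data.List using (List; []; _∷_)
open import Data.List.Relation.Unary.All using (All)
open import Data.Product using (Σ; ∃; _×_)
open import Data.Sum using (_⊎_)
open import Relation.Binary.PropositionalEquality using (_≡_; _≢_)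
open import Relation.Nullary using (¬_; does)
open import Data.Bool using (if_then_else_)

h : ℕ → ℕ
h zero = 0
h (suc zero) = 1
h (suc (suc k)) = h (suc k) + h k

-- Vectors in Z_{≥0}^N are Vec ℕ N; the 0-based index k corresponds to the
-- paper's position k+1.

dot : ∀ {N} → Vec ℕ N → Vec ℕ N → ℕ
dot u v = foldr (λ _ → ℕ) _+_ 0 (zipWith _*_ u v)

row₁ : ∀ N → Vec ℕ N
row₁ N = tabulate (λ k → h (suc (toℕ k)))

row₂ : ∀ N → Vec ℕ N
row₂ N = tabulate (λ k → h (toℕ k))

InV : ∀ N → ℕ → Vec ℕ N → Set
InV N n x = (dot (row₁ N) x ≡ h n) × (dot (row₂ N) x ≡ h (n ∸ 1))

-- entry at 0-based position m (0 outside the range)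
at : List ℕ → ℕ → ℕ
at [] _ = 0
at (a ∷ _) zero = a
at (_ ∷ as) (suc m) = at as m

entry : ∀ {N} → Vec ℕ N → ℕ → ℕ
entry z m = at (toList z) m

-- x_n(i): entry h_{n+1-i} at (1-based) position i-2, h_{n+2-i} at position i-1,
-- 0 elsewhere.  0-based index k is position k+1, so position i-2 ⇔ k+3 = i,
-- position i-1 ⇔ k+2 = i.
xvec : ∀ N → ℕ → ℕ → Vec ℕ N
xvec N n i = tabulate (λ k →
  if does (toℕ k + 3 ≟ i) then h ((n + 1) ∸ i)
  else if does (toℕ k + 2 ≟ i) then h ((n + 2) ∸ i)
  else 0)

-- x_1(2) = (1,0,...,0)
e₁ : ∀ N → Vec ℕ N
e₁ N = tabulate (λ k → if does (toℕ k ≟ 0) then 1 else 0)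

InS : ∀ N → ℕ → Vec ℕ N → Set
InS N n x =
  (n ≡ 1 × x ≡ e₁ N)
  ⊎ (2 ≤ n × Σ ℕ (λ i → 3 ≤ i × i ≤ n + 1 × x ≡ xvec N n i))

AlmostCF : ∀ {N} → Vec ℕ N → Set
AlmostCF z = ∀ j i → suc j < i → entry z j * entry z (suc j) ≢ 0 → entry z i ≡ 0

InC : ∀ N → ℕ → Vec ℕ N → Set
InC N n z = InV N n z × AlmostCF z

vsum : ∀ {N} → List (Vec ℕ N) → Vec ℕ N
vsum [] = replicate _ 0
vsum (x ∷ xs) = zipWith _+_ x (vsum xs)

InVUpTo : ∀ N → ℕ → Vec ℕ N → Set
InVUpTo N n x = Σ ℕ (λ j → 1 ≤ j × j ≤ n × InV N j x)

InSUpTo : ∀ N → ℕ → Vec ℕ N → Set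
InSUpTo N n x = Σ ℕ (λ j → 1 ≤ j × j ≤ n × InS N j x)

-- A factorization of z (z ∈ V_n) is a list of elements of ⋃_{i≤n} V_i summing
-- to z; the trivial factorization is the one-element list (z).
-- z is S-restricted iff every non-trivial factorization is S-type.
SRestricted : ∀ N → ℕ → Vec ℕ N → Set
SRestricted N n z =
  (fs : List (Vec ℕ N)) → All (InVUpTo N n) fs → vsum fs ≡ z →
  fs ≢ (z ∷ []) → All (InSUpTo N n) fs

InR : ∀ N → ℕ → Vec ℕ N → Set
InR N n z = InC N n z × SRestricted N n z

{-# OPTIONS --safe #-}
module Submission where

-- Call y a non-S summand of z ∈ V_n if y ≤ z componentwise, y ≠ z, y ∈ V_j for
-- some j ≤ n, and y lies in no S_j.  Since the k-th unit vector lies in V_{k+1},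
-- such a y together with the unit vectors making up z − y is a non-trivial
-- factorization of z that is not S-type.  Conversely, every factor of a
-- non-trivial factorization is ≤ z and ≠ z (all factors have positive weight),
-- so a factor outside S is a non-S summand.  Hence z ∉ R_n iff z has a non-S
-- summand.  Any x ∈ R_i \ S_i below z with i < n is one, because the level of an
-- element of some V_j is unique.  Conversely a non-S summand y of z ∈ C_n lies in
-- C_j \ S_j with j < n, and a non-S summand of y is one of z; as having one is
-- decidable, descending in the level ends at some x ∈ R_i \ S_i below z.

open import Defs
open import Data.Nat using (ℕ; zero; suc; _+_; _*_; _∸_; _≤_; _<_; z≤n; s≤s; _≤?_; _<?_)
open import Data.Nat.Properties
open import Data.Nat.Induction using (<-wellFounded)
open import Data.Nat.Solver using (module +-*-Solver)
open import Data.Fin using (Fin; toℕ) renaming (zero to fzero; suc to fsuc)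
open import Data.Vec using (Vec; []; _∷_; lookup; tabulate; zipWith; replicate)
open import Data.Vec.Properties
  using (zipWith-assoc; zipWith-comm; zipWith-identityˡ; zipWith-identityʳ;
         lookup-replicate; lookup∘tabulate; ≡-dec)
open import Data.List using (List; []; _∷_; _++_; map)
import Data.List as List
open import Data.List.Properties using (∷-injectiveˡ)
open import Data.List.Relation.Unary.All as All using (All; []; _∷_)
open import Data.List.Relation.Unary.All.Properties using (++⁺; map⁺; replicate⁺)
open import Data.Product using (Σ; ∃; _×_; _,_; proj₁; proj₂)
open import Data.Sum using (_⊎_; inj₁; inj₂)
open import Data.Bool using (if_then_else_)
open import Function.Base using (_∘_)
open import Function.Bundles using (_⇔_; mk⇔)
open import Induction.WellFounded using (Acc; acc)
open import Relation.Nullary using (¬_; Dec; yes; no; does; contradiction)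
open import Relation.Nullary.Decidable using (_×-dec_; _⊎-dec_; ¬?; map′; decidable-stable)
open import Relation.Binary.PropositionalEquality
open ≡-Reasoning

h-pos : ∀ k → 1 ≤ h (suc k)
h-pos zero    = s≤s z≤n
h-pos (suc k) = ≤-trans (h-pos k) (m≤m+n (h (suc k)) (h k))

h-mono-≤ : ∀ {a b} → a ≤ b → h a ≤ h b
h-mono-≤ z≤n                     = z≤n
h-mono-≤ {b = suc b} (s≤s z≤n)   = h-pos b
h-mono-≤ (s≤s (s≤s a≤b))         = +-mono-≤ (h-mono-≤ (s≤s a≤b)) (h-mono-≤ a≤b)

h-<-suc : ∀ m → h (2 + m) < h (3 + m)
h-<-suc m = m<m+n (h (2 + m)) (h-pos m)

h-+ : ∀ a b → h (suc (a + b)) ≡ h a * h b + h (suc a) * h (suc b)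
h-+ zero b = sym (+-identityʳ (h (suc b)))
h-+ (suc zero) b =
  solve 2 (λ x y → y :+ x := (con 1 :* x) :+ (con 1 :* y)) refl (h b) (h (suc b))
  where open +-*-Solver
h-+ (suc (suc a)) b =
  trans (cong₂ _+_ (h-+ (suc a) b) (h-+ a b))
        (solve 4 (λ x y u v → (y :* u :+ (y :+ x) :* v) :+ (x :* u :+ y :* v)
                     := (y :+ x) :* u :+ ((y :+ x) :+ y) :* v)
               refl (h a) (h (suc a)) (h b) (h (suc b)))
  where open +-*-Solver

h-pair-injective : ∀ a b → h (suc a) ≡ h (suc b) → h a ≡ h b → a ≡ b
h-pair-injective zero    zero    _ _ = refl
h-pair-injective zero    (suc b) _ e = contradiction e (<⇒≢ (h-pos b))
h-pair-injective (suc a) zero    _ e = contradiction (sym e) (<⇒≢ (h-pos a))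
h-pair-injective (suc a) (suc b) e₁ e₂ =
  cong suc (h-pair-injective a b e₂
    (+-cancelˡ-≡ (h (suc a)) (h a) (h b) (trans e₁ (cong (_+ h b) (sym e₂)))))

h-index-bound : ∀ n k → h (suc k) ≤ h n → h k ≤ h (n ∸ 1) → k < n
h-index-bound zero          k       p _ = contradiction (≤-trans (h-pos k) p) λ ()
h-index-bound (suc zero)    zero    _ _ = s≤s z≤n
h-index-bound (suc zero)    (suc k) _ q = contradiction (≤-trans (h-pos k) q) λ ()
h-index-bound (suc (suc m)) k       p _ with k <? suc (suc m)
... | yes k<n = k<n
... | no  k≮n = contradiction (≤-trans (h-mono-≤ (s≤s (≮⇒≥ k≮n))) p) (<⇒≱ (h-<-suc m))

infix  4 _≤ᵛ_
infixl 6 _+ᵛ_ _∸ᵛ_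

_≤ᵛ_ : ∀ {N} → Vec ℕ N → Vec ℕ N → Set
_≤ᵛ_ {N} x z = (k : Fin N) → lookup x k ≤ lookup z k

_+ᵛ_ _∸ᵛ_ : ∀ {N} → Vec ℕ N → Vec ℕ N → Vec ℕ N
_+ᵛ_ = zipWith _+_
_∸ᵛ_ = zipWith _∸_

0ᵛ : ∀ {N} → Vec ℕ N
0ᵛ = replicate _ 0

≤ᵛ-trans : ∀ {N} {x y z : Vec ℕ N} → x ≤ᵛ y → y ≤ᵛ z → x ≤ᵛ z
≤ᵛ-trans p q k = ≤-trans (p k) (q k)

≤ᵛ-+ᵛ : ∀ {N} (y r : Vec ℕ N) → y ≤ᵛ y +ᵛ r
≤ᵛ-+ᵛ (a ∷ y) (b ∷ r) fzero    = m≤m+n a b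
≤ᵛ-+ᵛ (a ∷ y) (b ∷ r) (fsuc k) = ≤ᵛ-+ᵛ y r k

+ᵛ-∸ᵛ : ∀ {N} {y z : Vec ℕ N} → y ≤ᵛ z → y +ᵛ (z ∸ᵛ y) ≡ z
+ᵛ-∸ᵛ {y = []}    {[]}    _   = refl
+ᵛ-∸ᵛ {y = a ∷ y} {b ∷ z} y≤z = cong₂ _∷_ (m+[n∸m]≡n (y≤z fzero)) (+ᵛ-∸ᵛ (y≤z ∘ fsuc))

+ᵛ-identityʳ : ∀ {N} (v : Vec ℕ N) → v +ᵛ 0ᵛ ≡ v
+ᵛ-identityʳ = zipWith-identityʳ +-identityʳ

+ᵛ-assoc : ∀ {N} (a b c : Vec ℕ N) → a +ᵛ b +ᵛ c ≡ a +ᵛ (b +ᵛ c)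
+ᵛ-assoc = zipWith-assoc +-assoc

+ᵛ-leftComm : ∀ {N} (a b c : Vec ℕ N) → a +ᵛ (b +ᵛ c) ≡ b +ᵛ (a +ᵛ c)
+ᵛ-leftComm a b c = begin
  a +ᵛ (b +ᵛ c)  ≡⟨ +ᵛ-assoc a b c ⟨
  a +ᵛ b +ᵛ c    ≡⟨ cong (_+ᵛ c) (zipWith-comm +-comm a b) ⟩
  b +ᵛ a +ᵛ c    ≡⟨ +ᵛ-assoc b a c ⟩
  b +ᵛ (a +ᵛ c)  ∎

entry-mono : ∀ {N} (x z : Vec ℕ N) → x ≤ᵛ z → ∀ k → entry x k ≤ entry z k
entry-mono []      []      _   _       = z≤n
entry-mono (a ∷ x) (b ∷ z) x≤z zero    = x≤z fzero
entry-mono (a ∷ x) (b ∷ z) x≤z (suc k) = entry-mono x z (x≤z ∘ fsuc) k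

entry-∸ᵛ : ∀ {N} (z y : Vec ℕ N) k → entry (z ∸ᵛ y) k ≤ entry z k
entry-∸ᵛ []      []      _       = z≤n
entry-∸ᵛ (b ∷ z) (a ∷ y) zero    = m∸n≤m b a
entry-∸ᵛ (b ∷ z) (a ∷ y) (suc k) = entry-∸ᵛ z y k

AlmostCF-≤ᵛ : ∀ {N} (y z : Vec ℕ N) → y ≤ᵛ z → AlmostCF z → AlmostCF y
AlmostCF-≤ᵛ y z y≤z acf j i j+1<i yⱼyⱼ₊₁≢0 =
  n≤0⇒n≡0 (≤-trans (entry-mono y z y≤z i) (≤-reflexive (acf j i j+1<i zⱼzⱼ₊₁≢0)))
  where
    zⱼzⱼ₊₁≢0 : entry z j * entry z (suc j) ≢ 0
    zⱼzⱼ₊₁≢0 e = yⱼyⱼ₊₁≢0 (n≤0⇒n≡0 (≤-trans (*-mono-≤ (entry-mono y z y≤z j)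
                                                          (entry-mono y z y≤z (suc j)))
                                              (≤-reflexive e)))

weights : (ℕ → ℕ) → ∀ N → Vec ℕ N
weights f N = tabulate (f ∘ toℕ)

value : ∀ {N} → Vec ℕ N → ℕ
value {N} = dot (row₁ N)

dot-zeroʳ : ∀ {N} (u v : Vec ℕ N) → (∀ k → lookup v k ≡ 0) → dot u v ≡ 0
dot-zeroʳ []      []      _   = refl
dot-zeroʳ (c ∷ u) (a ∷ v) v≡0 =
  cong₂ _+_ (trans (cong (c *_) (v≡0 fzero)) (*-zeroʳ c)) (dot-zeroʳ u v (v≡0 ∘ fsuc))

dot-+ᵛ : ∀ {N} (u a b : Vec ℕ N) → dot u (a +ᵛ b) ≡ dot u a + dot u b
dot-+ᵛ []      []      []      = refl
dot-+ᵛ (c ∷ u) (x ∷ a) (y ∷ b) =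
  trans (cong (c * (x + y) +_) (dot-+ᵛ u a b))
        (solve 5 (λ c x y p q → c :* (x :+ y) :+ (p :+ q) := (c :* x :+ p) :+ (c :* y :+ q))
               refl c x y (dot u a) (dot u b))
  where open +-*-Solver

weight*entry≤dot : ∀ f {N} (z : Vec ℕ N) k → f k * entry z k ≤ dot (weights f N) z
weight*entry≤dot f []      k       = ≤-reflexive (*-zeroʳ (f k))
weight*entry≤dot f (a ∷ z) zero    = m≤m+n (f 0 * a) _
weight*entry≤dot f (a ∷ z) (suc k) = ≤-trans (weight*entry≤dot (f ∘ suc) z k) (m≤n+m _ (f 0 * a))

weight≤dot : ∀ f {N} (z : Vec ℕ N) k → 1 ≤ entry z k → f k ≤ dot (weights f N) z
weight≤dot f z k 1≤zₖ =
  ≤-trans (≤-reflexive (sym (*-identityʳ (f k))))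
          (≤-trans (*-monoʳ-≤ (f k) 1≤zₖ) (weight*entry≤dot f z k))

dot-weights≡0 : ∀ f → (∀ k → 1 ≤ f k) → ∀ {N} (w : Vec ℕ N) →
  dot (weights f N) w ≡ 0 → w ≡ 0ᵛ
dot-weights≡0 f f≥1 []      _ = refl
dot-weights≡0 f f≥1 (a ∷ w) e with m*n≡0⇒m≡0∨n≡0 (f 0) (m+n≡0⇒m≡0 (f 0 * a) e)
... | inj₁ f0≡0 = contradiction (sym f0≡0) (<⇒≢ (f≥1 0))
... | inj₂ refl = cong (0 ∷_) (dot-weights≡0 (f ∘ suc) (f≥1 ∘ suc) w (m+n≡0⇒n≡0 (f 0 * a) e))

value-+ᵛ : ∀ {N} (y r : Vec ℕ N) → value (y +ᵛ r) ≡ value y + value r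
value-+ᵛ {N} = dot-+ᵛ (row₁ N)

value-+ᵛ-positiveˡ : ∀ {N} (y r : Vec ℕ N) → 1 ≤ value y → 1 ≤ value (y +ᵛ r)
value-+ᵛ-positiveˡ y r p = ≤-trans p (≤-trans (m≤m+n _ _) (≤-reflexive (sym (value-+ᵛ y r))))

≢+ᵛ-positive : ∀ {N} {y r : Vec ℕ N} → 1 ≤ value r → y ≢ y +ᵛ r
≢+ᵛ-positive {y = y} {r} p y≡y+r =
  <⇒≢ (m<m+n (value y) p) (trans (cong value y≡y+r) (value-+ᵛ y r))

≤ᵛ-value-antisym : ∀ {N} {y z : Vec ℕ N} → y ≤ᵛ z → value y ≡ value z → y ≡ z
≤ᵛ-value-antisym {y = y} {z} y≤z vy≡vz = begin
  y               ≡⟨ +ᵛ-identityʳ y ⟨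
  y +ᵛ 0ᵛ         ≡⟨ cong (y +ᵛ_) difference≡0 ⟨
  y +ᵛ (z ∸ᵛ y)   ≡⟨ +ᵛ-∸ᵛ y≤z ⟩
  z               ∎
  where
    value-difference : value y + value (z ∸ᵛ y) ≡ value y + 0
    value-difference = begin
      value y + value (z ∸ᵛ y)  ≡⟨ value-+ᵛ y (z ∸ᵛ y) ⟨
      value (y +ᵛ (z ∸ᵛ y))     ≡⟨ cong value (+ᵛ-∸ᵛ y≤z) ⟩
      value z                   ≡⟨ vy≡vz ⟨
      value y                   ≡⟨ +-identityʳ (value y) ⟨
      value y + 0               ∎
    difference≡0 : z ∸ᵛ y ≡ 0ᵛ
    difference≡0 = dot-weights≡0 (h ∘ suc) h-pos (z ∸ᵛ y) (+-cancelˡ-≡ (value y) _ _ value-difference)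

InV-level-unique : ∀ {N} i n {z : Vec ℕ N} → InV N i z → InV N n z → i ≡ n
InV-level-unique zero    zero    _         _         = refl
InV-level-unique zero    (suc n) (a₁ , _)  (b₁ , _)  = contradiction (trans (sym a₁) b₁) (<⇒≢ (h-pos n))
InV-level-unique (suc i) zero    (a₁ , _)  (b₁ , _)  = contradiction (trans (sym b₁) a₁) (<⇒≢ (h-pos i))
InV-level-unique (suc i) (suc n) (a₁ , a₂) (b₁ , b₂) =
  cong suc (h-pair-injective i n (trans (sym a₁) b₁) (trans (sym a₂) b₂))

InV-support : ∀ {N n} (z : Vec ℕ N) → InV N n z → ∀ k → 1 ≤ entry z k → k < n
InV-support {n = n} z (v₁ , v₂) k 1≤zₖ =
  h-index-bound n k (≤-trans (weight≤dot (h ∘ suc) z k 1≤zₖ) (≤-reflexive v₁))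
                    (≤-trans (weight≤dot h z k 1≤zₖ) (≤-reflexive v₂))

InVUpTo⇒value-positive : ∀ {N n} (y : Vec ℕ N) → InVUpTo N n y → 1 ≤ value y
InVUpTo⇒value-positive y (suc j , _ , _ , v₁ , _) = ≤-trans (h-pos j) (≤-reflexive (sym v₁))

-- xvec N n i is tabulate (pairAt (h (n + 1 ∸ i)) (h (n + 2 ∸ i)) i ∘ toℕ) by unfolding.
pairAt : ℕ → ℕ → ℕ → ℕ → ℕ
pairAt a b i k = if does (k + 3 ≟ i) then a else if does (k + 2 ≟ i) then b else 0

pairAt-beyond : ∀ a b k → pairAt a b 3 (2 + k) ≡ 0
pairAt-beyond a b k rewrite +-comm k 3 | +-comm k 2 = refl

dot-pairAt : ∀ f a b p {N} → 2 + p ≤ N →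
  dot (weights f N) (tabulate (pairAt a b (3 + p) ∘ toℕ)) ≡ f p * a + f (suc p) * b
dot-pairAt f a b zero {suc (suc N)} _ = begin
  f 0 * a + (f 1 * b + dot (weights (f ∘ suc ∘ suc) N) rest)
    ≡⟨ cong (λ t → f 0 * a + (f 1 * b + t)) rest·0 ⟩
  f 0 * a + (f 1 * b + 0)
    ≡⟨ cong (f 0 * a +_) (+-identityʳ (f 1 * b)) ⟩
  f 0 * a + f 1 * b
    ∎
  where
    rest : Vec ℕ N
    rest = tabulate (λ k → pairAt a b 3 (2 + toℕ k))
    rest·0 : dot (weights (f ∘ suc ∘ suc) N) rest ≡ 0
    rest·0 = dot-zeroʳ (weights (f ∘ suc ∘ suc) N) rest
               (λ k → trans (lookup∘tabulate _ k) (pairAt-beyond a b (toℕ k)))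
dot-pairAt f a b zero {suc zero} (s≤s ())
dot-pairAt f a b (suc p) {suc N} (s≤s 2+p≤N) =
  trans (cong (_+ dot (weights (f ∘ suc) N) (tabulate (pairAt a b (3 + p) ∘ toℕ))) (*-zeroʳ (f 0)))
        (dot-pairAt (f ∘ suc) a b p 2+p≤N)

xvec∈V : ∀ N p q → 2 + p + q ≤ N → InV N (2 + p + q) (xvec N (2 + p + q) (3 + p))
xvec∈V N p q 2+p+q≤N =
  trans (dot-pairAt (h ∘ suc) _ _ p 2+p≤N)
        (trans (cong₂ (λ a b → h (suc p) * h a + h (2 + p) * h b) ([n+1]∸i≡q p q) ([n+2]∸i≡1+q p q))
               (sym (h-+ (suc p) q)))
  , trans (dot-pairAt h _ _ p 2+p≤N)
          (trans (cong₂ (λ a b → h p * h a + h (suc p) * h b) ([n+1]∸i≡q p q) ([n+2]∸i≡1+q p q))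
                 (sym (h-+ p q)))
  where
    2+p≤N : 2 + p ≤ N
    2+p≤N = ≤-trans (s≤s (s≤s (m≤m+n p q))) 2+p+q≤N
    [n+1]∸i≡q : ∀ p q → (2 + p + q + 1) ∸ (3 + p) ≡ q
    [n+1]∸i≡q p q = trans (cong (_∸ suc p) (+-comm (p + q) 1)) (m+n∸m≡n (suc p) q)
    [n+2]∸i≡1+q : ∀ p q → (2 + p + q + 2) ∸ (3 + p) ≡ suc q
    [n+2]∸i≡1+q p q =
      trans (cong (_∸ suc p) (solve 2 (λ p q → (p :+ q) :+ con 2 := (con 1 :+ p) :+ (con 1 :+ q)) refl p q))
            (m+n∸m≡n (suc p) (suc q))
      where open +-*-Solver

InS⇒InV : ∀ {N j} {x : Vec ℕ N} → j ≤ N → InS N j x → InV N j x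
InS⇒InV {zero}  () (inj₁ (refl , _))
InS⇒InV {suc N} _  (inj₁ (refl , refl)) = cong (1 +_) (tail·0 (h ∘ suc ∘ suc)) , tail·0 (h ∘ suc)
  where
    tail·0 : ∀ f → dot (weights f N) (tabulate (λ _ → 0)) ≡ 0
    tail·0 f = dot-zeroʳ (weights f N) _ (lookup∘tabulate _)
InS⇒InV {N} {j} j≤N (inj₂ (_ , suc (suc (suc p)) , s≤s (s≤s (s≤s z≤n)) , i≤j+1 , refl)) =
  subst (λ j → InV N j (xvec N j (3 + p))) 2+p+[j∸2+p]≡j
        (xvec∈V N p (j ∸ (2 + p)) (≤-trans (≤-reflexive 2+p+[j∸2+p]≡j) j≤N))
  where
    2+p+[j∸2+p]≡j : 2 + p + (j ∸ (2 + p)) ≡ j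
    2+p+[j∸2+p]≡j = m+[n∸m]≡n (≤-pred (≤-trans i≤j+1 (≤-reflexive (+-comm j 1))))

IsUnitAt : ∀ {N} → ℕ → Vec ℕ N → Set
IsUnitAt {N} k u = ∀ f → dot (weights f N) u ≡ f k

IsUnitAt⇒InV : ∀ {N k} (u : Vec ℕ N) → IsUnitAt k u → InV N (suc k) u
IsUnitAt⇒InV u e = e (h ∘ suc) , e h

units : ∀ {N} → Vec ℕ N → List (Vec ℕ N)
units []      = []
units (a ∷ w) = List.replicate a (1 ∷ 0ᵛ) ++ map (0 ∷_) (units w)

vsum-++ : ∀ {N} (A B : List (Vec ℕ N)) → vsum (A ++ B) ≡ vsum A +ᵛ vsum B
vsum-++ []      B = sym (zipWith-identityˡ +-identityˡ (vsum B))
vsum-++ (a ∷ A) B = trans (cong (a +ᵛ_) (vsum-++ A B)) (sym (+ᵛ-assoc a (vsum A) (vsum B)))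

vsum-units : ∀ {N} (w : Vec ℕ N) → vsum (units w) ≡ w
vsum-units []      = refl
vsum-units {suc N} (a ∷ w) = begin
  vsum (List.replicate a (1 ∷ 0ᵛ) ++ map (0 ∷_) (units w))
    ≡⟨ vsum-++ (List.replicate a _) _ ⟩
  vsum (List.replicate a (1 ∷ 0ᵛ)) +ᵛ vsum (map (0 ∷_) (units w))
    ≡⟨ cong₂ _+ᵛ_ (vsum-replicate a) (vsum-map (units w)) ⟩
  (a ∷ 0ᵛ) +ᵛ (0 ∷ vsum (units w))
    ≡⟨ cong₂ _∷_ (+-identityʳ a) (zipWith-identityˡ +-identityˡ _) ⟩
  a ∷ vsum (units w)
    ≡⟨ cong (a ∷_) (vsum-units w) ⟩
  a ∷ w
    ∎
  where
    vsum-replicate : ∀ c → vsum (List.replicate c (1 ∷ 0ᵛ)) ≡ c ∷ 0ᵛ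
    vsum-replicate zero    = refl
    vsum-replicate (suc c) =
      trans (cong ((1 ∷ 0ᵛ) +ᵛ_) (vsum-replicate c)) (cong (suc c ∷_) (zipWith-identityˡ +-identityˡ 0ᵛ))
    vsum-map : ∀ (A : List (Vec ℕ N)) → vsum (map (0 ∷_) A) ≡ 0 ∷ vsum A
    vsum-map []      = refl
    vsum-map (x ∷ A) = cong ((0 ∷ x) +ᵛ_) (vsum-map A)

UnitInSupport : ∀ {N} → Vec ℕ N → Vec ℕ N → Set
UnitInSupport w u = ∃ λ k → 1 ≤ entry w k × IsUnitAt k u

units-inSupport : ∀ {N} (w : Vec ℕ N) → All (UnitInSupport w) (units w)
units-inSupport []              = []
units-inSupport {suc N} (a ∷ w) = ++⁺ (first a) (map⁺ (All.map shift (units-inSupport w)))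
  where
    first : ∀ c → All (UnitInSupport (c ∷ w)) (List.replicate c (1 ∷ 0ᵛ))
    first zero    = []
    first (suc c) = replicate⁺ (suc c) (0 , s≤s z≤n , λ f →
      trans (cong₂ _+_ (*-identityʳ (f 0)) (dot-zeroʳ (weights (f ∘ suc) N) 0ᵛ (λ k → lookup-replicate k 0)))
            (+-identityʳ (f 0)))
    shift : ∀ {u} → UnitInSupport w u → UnitInSupport (a ∷ w) (0 ∷ u)
    shift {u} (k , 1≤wₖ , e) = suc k , 1≤wₖ , λ f →
      trans (cong (_+ dot (weights (f ∘ suc) N) u) (*-zeroʳ (f 0))) (e (f ∘ suc))

unitCompletion : ∀ {N n} {y z : Vec ℕ N} → InV N n z → y ≤ᵛ z →
  All (InVUpTo N n) (units (z ∸ᵛ y)) × vsum (y ∷ units (z ∸ᵛ y)) ≡ z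
unitCompletion {N} {n} {y} {z} vz y≤z =
  All.map unit∈VUpTo (units-inSupport (z ∸ᵛ y))
  , trans (cong (y +ᵛ_) (vsum-units (z ∸ᵛ y))) (+ᵛ-∸ᵛ y≤z)
  where
    unit∈VUpTo : ∀ {u} → UnitInSupport (z ∸ᵛ y) u → InVUpTo N n u
    unit∈VUpTo {u} (k , 1≤wₖ , e) =
      suc k , s≤s z≤n , InV-support z vz k (≤-trans 1≤wₖ (entry-∸ᵛ z y k)) , IsUnitAt⇒InV u e

SplitsOff : ∀ {N} → List (Vec ℕ N) → Vec ℕ N → Set
SplitsOff fs y = ∃ λ r → vsum fs ≡ y +ᵛ r × (fs ≡ y ∷ [] ⊎ 1 ≤ value r)

splitOff : ∀ {N n} {fs : List (Vec ℕ N)} → All (InVUpTo N n) fs → All (SplitsOff fs) fs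
splitOff []                               = []
splitOff {N} {n} {a ∷ rest} (a∈V ∷ rest∈V) =
  (vsum rest , refl , singleOrPositive rest∈V) ∷ All.map extend (splitOff rest∈V)
  where
    singleOrPositive : ∀ {rest} → All (InVUpTo N n) rest → a ∷ rest ≡ a ∷ [] ⊎ 1 ≤ value (vsum rest)
    singleOrPositive []          = inj₁ refl
    singleOrPositive {b ∷ _} (b∈V ∷ _) = inj₂ (value-+ᵛ-positiveˡ b _ (InVUpTo⇒value-positive b b∈V))
    extend : ∀ {y} → SplitsOff rest y → SplitsOff (a ∷ rest) y
    extend {y} (r , rest≡y+r , _) =
      a +ᵛ r , trans (cong (a +ᵛ_) rest≡y+r) (+ᵛ-leftComm a y r)
      , inj₂ (value-+ᵛ-positiveˡ a r (InVUpTo⇒value-positive a a∈V))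

NonSSummand : ∀ N → ℕ → Vec ℕ N → Vec ℕ N → Set
NonSSummand N n z y = y ≤ᵛ z × y ≢ z × InVUpTo N n y × ¬ InSUpTo N n y

HasNonSSummand : ∀ N → ℕ → Vec ℕ N → Set
HasNonSSummand N n z = ∃ (NonSSummand N n z)

between? : ∀ {P : ℕ → Set} → (∀ i → Dec (P i)) → ∀ lo hi → Dec (∃ λ i → lo ≤ i × i ≤ hi × P i)
between? P? lo hi =
  map′ (λ { (i , s≤s i≤hi , lo≤i , p) → i , lo≤i , i≤hi , p })
       (λ { (i , lo≤i , i≤hi , p) → i , s≤s i≤hi , lo≤i , p })
       (anyUpTo? (λ i → lo ≤? i ×-dec P? i) (suc hi))

any≤ᵛ? : ∀ {N} {P : Vec ℕ N → Set} → (∀ y → Dec (P y)) → (z : Vec ℕ N) → Dec (∃ λ y → y ≤ᵛ z × P y)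
any≤ᵛ? P? [] = map′ (λ p → [] , (λ ()) , p) (λ { ([] , _ , p) → p }) (P? [])
any≤ᵛ? P? (a ∷ z) =
  map′ (λ { (c , s≤s c≤a , y , y≤z , p) → c ∷ y , (λ { fzero → c≤a ; (fsuc k) → y≤z k }) , p })
       (λ { (c ∷ y , cy≤az , p) → c , s≤s (cy≤az fzero) , y , cy≤az ∘ fsuc , p })
       (anyUpTo? (λ c → any≤ᵛ? (λ y → P? (c ∷ y)) z) (suc a))

InV? : ∀ N j (x : Vec ℕ N) → Dec (InV N j x)
InV? N j x = (dot (row₁ N) x ≟ h j) ×-dec (dot (row₂ N) x ≟ h (j ∸ 1))

InS? : ∀ N n (x : Vec ℕ N) → Dec (InS N n x)
InS? N n x = ((n ≟ 1) ×-dec ≡-dec _≟_ x (e₁ N))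
       ⊎-dec ((2 ≤? n) ×-dec between? (λ i → ≡-dec _≟_ x (xvec N n i)) 3 (n + 1))

hasNonSSummand? : ∀ N n (z : Vec ℕ N) → Dec (HasNonSSummand N n z)
hasNonSSummand? N n z = any≤ᵛ? (λ y → ¬? (≡-dec _≟_ y z)
                            ×-dec between? (λ j → InV? N j y) 1 n
                            ×-dec ¬? (between? (λ j → InS? N j y) 1 n)) z

nonSSummand⇒¬restricted : ∀ {N n} {z : Vec ℕ N} → InV N n z → HasNonSSummand N n z → ¬ SRestricted N n z
nonSSummand⇒¬restricted vz (y , y≤z , y≢z , y∈V , y∉S) restricted with unitCompletion vz y≤z
... | units∈V , sum≡z = y∉S (All.head (restricted _ (y∈V ∷ units∈V) sum≡z (y≢z ∘ ∷-injectiveˡ)))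

¬nonSSummand⇒restricted : ∀ {N n} {z : Vec ℕ N} → ¬ HasNonSSummand N n z → SRestricted N n z
¬nonSSummand⇒restricted {N} {n} {z} none fs fs∈V sum≡z nontrivial = All.zipWith inS (fs∈V , splitOff fs∈V)
  where
    inS : ∀ {y} → InVUpTo N n y × SplitsOff fs y → InSUpTo N n y
    inS {y} (y∈V , r , fs≡y+r , singleOrPositive) =
      decidable-stable (between? (λ j → InS? N j y) 1 n)
                       λ y∉S → none (y , y≤z , y≢z singleOrPositive , y∈V , y∉S)
      where
        z≡y+r : z ≡ y +ᵛ r
        z≡y+r = trans (sym sum≡z) fs≡y+r
        y≤z : y ≤ᵛ z
        y≤z = subst (y ≤ᵛ_) (sym z≡y+r) (≤ᵛ-+ᵛ y r)
        y≢z : fs ≡ y ∷ [] ⊎ 1 ≤ value r → y ≢ z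
        y≢z (inj₁ fs≡[y]) y≡z = nontrivial (trans fs≡[y] (cong (_∷ []) y≡z))
        y≢z (inj₂ r>0)    y≡z = ≢+ᵛ-positive r>0 (trans y≡z z≡y+r)

nonSSummand-lower : ∀ {N n} {z y : Vec ℕ N} → InC N n z → NonSSummand N n z y →
  ∃ λ j → 1 ≤ j × j < n × InC N j y × ¬ InS N j y
nonSSummand-lower {n = n} {z} {y} (vz , acf) (y≤z , y≢z , (j , 1≤j , j≤n , vy) , y∉S) =
  j , 1≤j , ≤∧≢⇒< j≤n j≢n , (vy , AlmostCF-≤ᵛ y z y≤z acf) , λ s → y∉S (j , 1≤j , j≤n , s)
  where
    j≢n : j ≢ n
    j≢n refl = y≢z (≤ᵛ-value-antisym y≤z (trans (proj₁ vy) (sym (proj₁ vz))))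

RestrictedNonSBelow : ∀ N → ℕ → Vec ℕ N → Set
RestrictedNonSBelow N n z = ∃ λ i → 1 ≤ i × i < n × ∃ λ x → InR N i x × ¬ InS N i x × x ≤ᵛ z

RestrictedNonSBelow-lift : ∀ {N j n} (y z : Vec ℕ N) → j < n → y ≤ᵛ z →
  RestrictedNonSBelow N j y → RestrictedNonSBelow N n z
RestrictedNonSBelow-lift y z j<n y≤z (i , 1≤i , i<j , x , x∈R , x∉S , x≤y) =
  i , 1≤i , <-trans i<j j<n , x , x∈R , x∉S , ≤ᵛ-trans {x = x} {y} {z} x≤y y≤z

nonSSummand⇒restrictedNonSBelow : ∀ {N} n → Acc _<_ n → (z : Vec ℕ N) → InC N n z →
  HasNonSSummand N n z → RestrictedNonSBelow N n z
nonSSummand⇒restrictedNonSBelow {N} n (acc below) z cz (y , summand) with nonSSummand-lower cz summand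
... | j , 1≤j , j<n , cy , y∉S with hasNonSSummand? N j y
...   | no  none = j , 1≤j , j<n , y , (cy , ¬nonSSummand⇒restricted none) , y∉S , proj₁ summand
...   | yes some = RestrictedNonSBelow-lift y z j<n (proj₁ summand)
                     (nonSSummand⇒restrictedNonSBelow j (below j<n) y cy some)

restrictedNonSBelow⇒nonSSummand : ∀ {N n} {z : Vec ℕ N} → n ≤ N → InV N n z →
  RestrictedNonSBelow N n z → HasNonSSummand N n z
restrictedNonSBelow⇒nonSSummand {n = n} {z} n≤N vz (i , 1≤i , i<n , x , ((vx , _) , _) , x∉Sᵢ , x≤z) =
  x , x≤z , x≢z , (i , 1≤i , <⇒≤ i<n , vx) , x∉S
  where
    x≢z : x ≢ z
    x≢z refl = <⇒≢ i<n (InV-level-unique i n {x} vx vz)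
    x∉S : ¬ InSUpTo _ _ x
    x∉S (j , _ , j≤n , s) with InV-level-unique j i {x} (InS⇒InV (≤-trans j≤n n≤N) s) vx
    ... | refl = x∉Sᵢ s

lemma3p2 : (N n : ℕ) → 1 ≤ n → n ≤ N → (z : Vec ℕ N) →
    InC N n z → ¬ InS N n z →
    ((¬ InR N n z) ⇔
      Σ ℕ (λ i → 1 ≤ i × i < n ×
        Σ (Vec ℕ N) (λ x → InR N i x × ¬ InS N i x ×
          ((k : Fin N) → lookup x k ≤ lookup z k))))
lemma3p2 N n _ n≤N z cz _ = mk⇔
  (λ z∉R → nonSSummand⇒restrictedNonSBelow n (<-wellFounded n) z cz
             (decidable-stable (hasNonSSummand? N n z) λ none → z∉R (cz , ¬nonSSummand⇒restricted none)))
  (λ below z∈R → nonSSummand⇒¬restricted (proj₁ cz)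
                   (restrictedNonSBelow⇒nonSSummand n≤N (proj₁ cz) below) (proj₂ z∈R))
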